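{- For positive integers $\ell,k$ with $1\le\ell<k$, $$\sum_{r=1}^k r!{k\brace r}=\sum_{p=1}^{\ell}\sum_{q=1}^{k-\ell}{\ell\brace p}{k-\ell\brace q}\,p!\,q!\,D(p,q).$$
   Context: ${m\brace r}$ denotes the Stirling number of the second kind. The Delannoy numbers $D(m,n)$ for nonnegative integers $m,n$ are defined by $D(m,n)=1$ if $mn=0$, and $D(m,n)=D(m-1,n)+D(m-1,n-1)+D(m,n-1)$ if $mn\neq0$. -}

module Defs where

open import Data.Nat using (ℕ; zero; suc; _+_; _*_)

stirling2 : ℕ → ℕ → ℕ
stirling2 zero    zero    = 1
stirling2 zero    (suc r) = 0
stirling2 (suc n) zero    = 0
stirling2 (suc n) (suc r) = suc r * stirling2 n (suc r) + stirling2 n r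

delannoy : ℕ → ℕ → ℕ
delannoy zero    n       = 1
delannoy (suc m) zero    = 1
delannoy (suc m) (suc n) = delannoy m (suc n) + delannoy m n + delannoy (suc m) n

sumFrom1 : ℕ → (ℕ → ℕ) → ℕ
sumFrom1 zero    f = 0
sumFrom1 (suc n) f = sumFrom1 n f + f (suc n)

-- Write surj n r = r! S(n,r) for the number of surjections from n points onto r, and
-- pairing l m = Σ_{p,q} surj l p * surj m q * D(p,q).  The recurrence of surj lets a weight X
-- be pushed from level n+1 to level n as r X(r) + (r+1) X(r+1); for X = D(·,q) the Delannoy
-- numbers satisfy p D(p,q) + (p+1) D(p+1,q) = q D(p,q) + (q+1) D(p,q+1), so pairing (l+1) m
-- = pairing l (m+1).  Sliding all of l across gives pairing 0 (l+m) = Σ_r surj (l+m) r, since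
-- D(0,q) = 1.

module Submission where

open import Data.List.Base using ([]; _∷_)
open import Data.Nat using (ℕ; zero; suc; _+_; _*_; _∸_; _≤_; _<_; _!; s≤s)
open import Data.Nat.Properties
  using (*-distribˡ-+; +-identityʳ; *-zeroʳ; *-identityʳ; +-suc; m≤n⇒m≤1+n; n<1+n; <⇒≤; m+[n∸m]≡n; m<n⇒0<n∸m)
open import Data.Nat.Tactic.RingSolver using (solve-∀; solve)
open import Relation.Binary.PropositionalEquality
  using (_≡_; refl; sym; trans; cong; cong₂; module ≡-Reasoning)

open import Defs

∑< : ℕ → (ℕ → ℕ) → ℕ
∑< zero    f = 0
∑< (suc n) f = ∑< n f + f n

syntax ∑< n (λ i → e) = ∑[ i < n ] e

∑-cong : ∀ n {f g : ℕ → ℕ} → (∀ i → f i ≡ g i) → ∑< n f ≡ ∑< n g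
∑-cong zero    f≗g = refl
∑-cong (suc n) f≗g = cong₂ _+_ (∑-cong n f≗g) (f≗g n)

∑-*-distribˡ : ∀ n c (f : ℕ → ℕ) → c * ∑< n f ≡ ∑[ i < n ] (c * f i)
∑-*-distribˡ zero    c f = *-zeroʳ c
∑-*-distribˡ (suc n) c f = begin
  c * (∑< n f + f n)             ≡⟨ *-distribˡ-+ c (∑< n f) (f n) ⟩
  c * ∑< n f + c * f n           ≡⟨ cong (_+ c * f n) (∑-*-distribˡ n c f) ⟩
  ∑[ i < n ] (c * f i) + c * f n ∎
  where open ≡-Reasoning

∑-linear : ∀ n a b (f g : ℕ → ℕ) → a * ∑< n f + b * ∑< n g ≡ ∑[ i < n ] (a * f i + b * g i)
∑-linear zero    a b f g = cong₂ _+_ (*-zeroʳ a) (*-zeroʳ b)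
∑-linear (suc n) a b f g = begin
  a * (∑< n f + f n) + b * (∑< n g + g n)       ≡⟨ regroup a b (∑< n f) (∑< n g) (f n) (g n) ⟩
  (a * ∑< n f + b * ∑< n g) + (a * f n + b * g n) ≡⟨ cong (_+ (a * f n + b * g n)) (∑-linear n a b f g) ⟩
  ∑[ i < suc n ] (a * f i + b * g i)              ∎
  where
  open ≡-Reasoning
  regroup : ∀ a b x y z w → a * (x + z) + b * (y + w) ≡ (a * x + b * y) + (a * z + b * w)
  regroup = solve-∀

sumFrom1-cong : ∀ n {f g : ℕ → ℕ} → (∀ i → f i ≡ g i) → sumFrom1 n f ≡ sumFrom1 n g
sumFrom1-cong zero    f≗g = refl
sumFrom1-cong (suc n) f≗g = cong₂ _+_ (sumFrom1-cong n f≗g) (f≗g (suc n))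

sumFrom1≡∑< : ∀ n (f : ℕ → ℕ) → f 0 ≡ 0 → sumFrom1 n f ≡ ∑< (suc n) f
sumFrom1≡∑< zero    f f0≡0 = sym f0≡0
sumFrom1≡∑< (suc n) f f0≡0 = cong (_+ f (suc n)) (sumFrom1≡∑< n f f0≡0)

delannoy-zeroʳ : ∀ p → delannoy p 0 ≡ 1
delannoy-zeroʳ zero    = refl
delannoy-zeroʳ (suc p) = refl

delannoy-oneʳ : ∀ p → delannoy p 1 ≡ suc (p + p)
delannoy-oneʳ zero    = refl
delannoy-oneʳ (suc p) rewrite delannoy-oneʳ p | delannoy-zeroʳ p = solve (p ∷ [])

delannoy-oneˡ : ∀ q → delannoy 1 q ≡ suc (q + q)
delannoy-oneˡ zero    = refl
delannoy-oneˡ (suc q) rewrite delannoy-oneˡ q = solve (q ∷ [])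

delannoy-balance : ∀ p q →
  p * delannoy p q + suc p * delannoy (suc p) q ≡ q * delannoy p q + suc q * delannoy p (suc q)
delannoy-balance zero    zero    = refl
delannoy-balance (suc p) zero    rewrite delannoy-oneʳ (suc p) = solve (p ∷ [])
delannoy-balance zero    (suc q) rewrite delannoy-oneˡ q = solve (q ∷ [])
-- After expanding the recurrence, the instance at (p+1, q+1) is the sum of the instances at
-- (p, q+1), (p, q) and (p+1, q), with 2 D(p+1, q+1) added to both sides.
delannoy-balance (suc p) (suc q) = begin
  suc p * d + (2 + p) * (d + c + e)
    ≡⟨ splitˡ p a b c e ⟩
  (p * a + suc p * d) + (p * b + suc p * c) + (suc p * c + (2 + p) * e) + 2 * d
    ≡⟨ cong (_+ 2 * d) (cong₂ _+_ (cong₂ _+_ (delannoy-balance p (suc q)) (delannoy-balance p q))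
                                   (delannoy-balance (suc p) q)) ⟩
  (suc q * a + (2 + q) * f) + (q * b + suc q * a) + (q * c + suc q * d) + 2 * d
    ≡⟨ splitʳ q a b c f ⟩
  suc q * d + (2 + q) * (f + a + d)
    ∎
  where
  open ≡-Reasoning
  a = delannoy p (suc q)
  b = delannoy p q
  c = delannoy (suc p) q
  d = a + b + c
  e = delannoy (suc (suc p)) q
  f = delannoy p (suc (suc q))
  splitˡ : ∀ p a b c e → let d = a + b + c in
    suc p * d + (2 + p) * (d + c + e)
      ≡ (p * a + suc p * d) + (p * b + suc p * c) + (suc p * c + (2 + p) * e) + 2 * d
  splitˡ = solve-∀
  splitʳ : ∀ q a b c f → let d = a + b + c in
    (suc q * a + (2 + q) * f) + (q * b + suc q * a) + (q * c + suc q * d) + 2 * d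
      ≡ suc q * d + (2 + q) * (f + a + d)
  splitʳ = solve-∀

stirling2-vanish : ∀ n r → n < r → stirling2 n r ≡ 0
stirling2-vanish zero    (suc r) _         = refl
stirling2-vanish (suc n) (suc r) (s≤s n<r)
  rewrite stirling2-vanish n (suc r) (m≤n⇒m≤1+n n<r) | stirling2-vanish n r n<r =
  trans (+-identityʳ (r * 0)) (*-zeroʳ r)

surj : ℕ → ℕ → ℕ
surj n r = r ! * stirling2 n r

surj-suc : ∀ n r → surj (suc n) (suc r) ≡ suc r * (surj n (suc r) + surj n r)
surj-suc n r = distribute (suc r) (r !) (stirling2 n (suc r)) (stirling2 n r)
  where
  distribute : ∀ s f x y → (s * f) * (s * x + y) ≡ s * ((s * f) * x + f * y)
  distribute = solve-∀

surj-vanish : ∀ n → surj n (suc n) ≡ 0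
surj-vanish n = trans (cong (suc n ! *_) (stirling2-vanish n (suc n) (n<1+n n))) (*-zeroʳ (suc n !))

∑-surj-suc-bounded : ∀ n N (X : ℕ → ℕ) →
  ∑[ r < suc N ] (surj (suc n) r * X r)
    ≡ ∑[ r < N ] (surj n r * (r * X r + suc r * X (suc r))) + N * surj n N * X N
∑-surj-suc-bounded n zero    X = refl
∑-surj-suc-bounded n (suc N) X = begin
  ∑[ r < suc N ] (surj (suc n) r * X r) + surj (suc n) (suc N) * X (suc N)
    ≡⟨ cong₂ (λ s t → s + t * X (suc N)) (∑-surj-suc-bounded n N X) (surj-suc n N) ⟩
  R + N * surj n N * X N + suc N * (surj n (suc N) + surj n N) * X (suc N)
    ≡⟨ regroup R N (surj n N) (surj n (suc N)) (X N) (X (suc N)) ⟩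
  R + surj n N * (N * X N + suc N * X (suc N)) + suc N * surj n (suc N) * X (suc N)
    ∎
  where
  open ≡-Reasoning
  R = ∑[ r < N ] (surj n r * (r * X r + suc r * X (suc r)))
  regroup : ∀ R N s t x y →
    R + N * s * x + suc N * (t + s) * y ≡ R + s * (N * x + suc N * y) + suc N * t * y
  regroup = solve-∀

∑-surj-suc : ∀ n (X : ℕ → ℕ) →
  ∑[ r < suc (suc n) ] (surj (suc n) r * X r)
    ≡ ∑[ r < suc n ] (surj n r * (r * X r + suc r * X (suc r)))
∑-surj-suc n X = begin
  ∑[ r < suc (suc n) ] (surj (suc n) r * X r)
    ≡⟨ ∑-surj-suc-bounded n (suc n) X ⟩
  R + suc n * surj n (suc n) * X (suc n)
    ≡⟨ cong (λ s → R + suc n * s * X (suc n)) (surj-vanish n) ⟩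
  R + suc n * 0 * X (suc n)
    ≡⟨ cong (λ s → R + s * X (suc n)) (*-zeroʳ (suc n)) ⟩
  R + 0
    ≡⟨ +-identityʳ R ⟩
  R ∎
  where
  open ≡-Reasoning
  R = ∑[ r < suc n ] (surj n r * (r * X r + suc r * X (suc r)))

delannoySum : ℕ → ℕ → ℕ
delannoySum m p = ∑[ q < suc m ] (surj m q * delannoy p q)

pairing : ℕ → ℕ → ℕ
pairing l m = ∑[ p < suc l ] (surj l p * delannoySum m p)

delannoySum-suc : ∀ m p → p * delannoySum m p + suc p * delannoySum m (suc p) ≡ delannoySum (suc m) p
delannoySum-suc m p = begin
  p * delannoySum m p + suc p * delannoySum m (suc p)
    ≡⟨ ∑-linear (suc m) p (suc p) _ _ ⟩
  ∑[ q < suc m ] (p * (surj m q * delannoy p q) + suc p * (surj m q * delannoy (suc p) q))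
    ≡⟨ ∑-cong (suc m) (λ q → trans (factor p (suc p) (surj m q) _ _) (cong (surj m q *_) (delannoy-balance p q))) ⟩
  ∑[ q < suc m ] (surj m q * (q * delannoy p q + suc q * delannoy p (suc q)))
    ≡⟨ ∑-surj-suc m (delannoy p) ⟨
  delannoySum (suc m) p
    ∎
  where
  open ≡-Reasoning
  factor : ∀ a b s x y → a * (s * x) + b * (s * y) ≡ s * (a * x + b * y)
  factor = solve-∀

pairing-shift : ∀ l m → pairing (suc l) m ≡ pairing l (suc m)
pairing-shift l m = trans (∑-surj-suc l (delannoySum m))
  (∑-cong (suc l) (λ p → cong (surj l p *_) (delannoySum-suc m p)))

pairing-zeroˡ : ∀ n → pairing 0 n ≡ ∑[ q < suc n ] surj n q
pairing-zeroˡ n = trans (+-identityʳ (delannoySum n 0)) (∑-cong (suc n) (λ q → *-identityʳ (surj n q)))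

pairing-invariant : ∀ l m → pairing l m ≡ ∑[ q < suc (l + m) ] surj (l + m) q
pairing-invariant zero    m = pairing-zeroˡ m
pairing-invariant (suc l) m = begin
  pairing (suc l) m                           ≡⟨ pairing-shift l m ⟩
  pairing l (suc m)                           ≡⟨ pairing-invariant l (suc m) ⟩
  ∑[ q < suc (l + suc m) ] surj (l + suc m) q ≡⟨ cong (λ k → ∑[ q < suc k ] surj k q) (+-suc l m) ⟩
  ∑[ q < suc (suc l + m) ] surj (suc l + m) q ∎
  where open ≡-Reasoning

surj-split : ∀ ℓ n → 1 ≤ ℓ → 1 ≤ n →
  sumFrom1 (ℓ + n) (λ r → (r !) * stirling2 (ℓ + n) r)
    ≡ sumFrom1 ℓ (λ p → sumFrom1 n (λ q →
        stirling2 ℓ p * stirling2 n q * (p !) * (q !) * delannoy p q))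
surj-split (suc l) (suc m) _ _ = begin
  sumFrom1 k (surj k)
    ≡⟨ sumFrom1≡∑< k (surj k) refl ⟩
  ∑[ r < suc k ] surj k r
    ≡⟨ pairing-invariant (suc l) (suc m) ⟨
  pairing (suc l) (suc m)
    ≡⟨ sumFrom1≡∑< (suc l) _ refl ⟨
  sumFrom1 (suc l) (λ p → surj (suc l) p * delannoySum (suc m) p)
    ≡⟨ sumFrom1-cong (suc l) inner ⟨
  sumFrom1 (suc l) (λ p → sumFrom1 (suc m) (term p))
    ∎
  where
  open ≡-Reasoning
  k = suc l + suc m
  term : ℕ → ℕ → ℕ
  term p q = stirling2 (suc l) p * stirling2 (suc m) q * (p !) * (q !) * delannoy p q
  reorder : ∀ s t f g d → s * t * f * g * d ≡ (f * s) * ((g * t) * d)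
  reorder = solve-∀
  inner : ∀ p → sumFrom1 (suc m) (term p) ≡ surj (suc l) p * delannoySum (suc m) p
  inner p = begin
    sumFrom1 (suc m) (term p)
      ≡⟨ sumFrom1-cong (suc m) (λ q → reorder _ _ (p !) (q !) _) ⟩
    sumFrom1 (suc m) (λ q → surj (suc l) p * (surj (suc m) q * delannoy p q))
      ≡⟨ sumFrom1≡∑< (suc m) _ (*-zeroʳ (surj (suc l) p)) ⟩
    ∑[ q < suc (suc m) ] (surj (suc l) p * (surj (suc m) q * delannoy p q))
      ≡⟨ ∑-*-distribˡ (suc (suc m)) (surj (suc l) p) _ ⟨
    surj (suc l) p * delannoySum (suc m) p
      ∎

theorem2 : (ℓ k : ℕ) → 1 ≤ ℓ → ℓ < k →
    sumFrom1 k (λ r → (r !) * stirling2 k r)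
      ≡ sumFrom1 ℓ (λ p → sumFrom1 (k ∸ ℓ) (λ q →
          stirling2 ℓ p * stirling2 (k ∸ ℓ) q * (p !) * (q !) * delannoy p q))
theorem2 ℓ k 1≤ℓ ℓ<k = begin
  sumFrom1 k (surj k)                         ≡⟨ cong (λ j → sumFrom1 j (surj j)) (m+[n∸m]≡n (<⇒≤ ℓ<k)) ⟨
  sumFrom1 (ℓ + (k ∸ ℓ)) (surj (ℓ + (k ∸ ℓ))) ≡⟨ surj-split ℓ (k ∸ ℓ) 1≤ℓ (m<n⇒0<n∸m ℓ<k) ⟩
  _                                           ∎
  where open ≡-Reasoning
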